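{- For every integer $n\geq 1$, the Grundy value in \textsc{ga1} of a single heap of size $n$ (i.e. a bit string of length $n$ all of whose bits are equal) equals the Grundy value of a single heap of size $n-1$ in \textsc{kayles}.
   Context: All games are impartial under normal play (the player unable to move loses); the Grundy value of a position is the minimum non-negative integer not among the Grundy values of its options. \textsc{ga1}: a position is a bit string $(a_1,\ldots,a_n)$; its \emph{entropy} is the number of consecutive sub-strings of the form $01$ or $10$. A move is either a crossover (choose $k$ with $1\leq k\leq n-1$ and flip all bits in positions $1$ through $k$) or a mutation (flip any single bit), and a move is legal only if it strictly increases the entropy. \textsc{kayles}: a position is a collection of heaps of stones; a move consists of removing one or two stones from a single heap and then, if stones remain in that heap, optionally splitting the remainder into two (nonempty) heaps. -}

module Defs where

open import Data.Bool using (Bool; true; false; not; if_then_else_; _xor_)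
open import Data.Nat using (ℕ; zero; suc; _+_; _∸_; _<?_; _≟_; _≤?_)
open import Data.Fin using (Fin)
open import Data.Vec using (Vec; []; _∷_; updateAt; replicate)
open import Data.List using (List; []; _∷_; _++_; map; filter; upTo; allFin; length; concat)
open import Data.Nat.ListAction using (sum)
open import Data.List.Membership.DecPropositional _≟_ using (_∈?_)
open import Data.Product using (_×_; _,_)
open import Relation.Nullary using (yes; no)

mexFrom : ℕ → ℕ → List ℕ → ℕ
mexFrom zero     k xs = k
mexFrom (suc f)  k xs with k ∈? xs
... | yes _ = mexFrom f (suc k) xs
... | no  _ = k

-- the answer is at most length xs, so (length xs) search steps suffice
mex : List ℕ → ℕ
mex xs = mexFrom (length xs) 0 xs

entropy : ∀ {n} → Vec Bool n → ℕ
entropy []               = 0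
entropy (x ∷ [])         = 0
entropy (x ∷ y ∷ xs)     = (if x xor y then 1 else 0) + entropy (y ∷ xs)

flipPrefix : ∀ {n} → ℕ → Vec Bool n → Vec Bool n
flipPrefix zero    v        = v
flipPrefix (suc k) []       = []
flipPrefix (suc k) (x ∷ xs) = not x ∷ flipPrefix k xs

crossovers : ∀ {n} → Vec Bool n → List (Vec Bool n)
crossovers {n} v = map (λ i → flipPrefix (suc i) v) (upTo (n ∸ 1))

mutations : ∀ {n} → Vec Bool n → List (Vec Bool n)
mutations {n} v = map (λ i → updateAt v i not) (allFin n)

ga1Moves : ∀ {n} → Vec Bool n → List (Vec Bool n)
ga1Moves v = filter (λ w → entropy v <? entropy w) (crossovers v ++ mutations v)

-- Grundy value with fuel; exact whenever fuel exceeds the length of the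
-- longest play from the position
ga1GrundyFuel : ∀ {n} → ℕ → Vec Bool n → ℕ
ga1GrundyFuel zero    v = 0
ga1GrundyFuel (suc f) v = mex (map (ga1GrundyFuel f) (ga1Moves v))

-- entropy lies in [0, n-1] and each move raises it by at least 1,
-- so every play from a length-n string has fewer than n moves: fuel n suffices
ga1Grundy : ∀ {n} → Vec Bool n → ℕ
ga1Grundy {n} v = ga1GrundyFuel n v

-- KAYLES: positions are lists of heap sizes (order irrelevant)

splits : ℕ → List (ℕ × ℕ)
splits r = map (λ i → suc i , r ∸ suc i) (upTo (r ∸ 1))

afterRemoval : ℕ → List ℕ → List (List ℕ)
afterRemoval zero    rest = rest ∷ []
afterRemoval (suc r) rest =
  (suc r ∷ rest) ∷ map (λ { (a , b) → a ∷ b ∷ rest }) (splits (suc r))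

removeK : ℕ → ℕ → List ℕ → List (List ℕ)
removeK k h rest with k Data.Nat.≤? h
... | yes _ = afterRemoval (h ∸ k) rest
... | no  _ = []

kaylesMoves : List ℕ → List (List ℕ)
kaylesMoves []       = []
kaylesMoves (h ∷ hs) =
  removeK 1 h hs ++ removeK 2 h hs ++ map (h ∷_) (kaylesMoves hs)

kaylesGrundyFuel : ℕ → List ℕ → ℕ
kaylesGrundyFuel zero    p = 0
kaylesGrundyFuel (suc f) p = mex (map (kaylesGrundyFuel f) (kaylesMoves p))

-- every move removes at least one stone, so total+1 fuel suffices
kaylesGrundy : List ℕ → ℕ
kaylesGrundy p = kaylesGrundyFuel (suc (sum p)) p

{-# OPTIONS --safe #-}
module Submission where

-- Read a bit string through its difference word, whose letters record which adjacent pairs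
-- differ; the entropy is the number of trues in it. A crossover flips one letter of the
-- difference word and a mutation flips one letter or two adjacent ones, so the legal moves are
-- exactly those turning one false, or two adjacent falses, into true. Reading each false as a
-- standing pin of a Kayles row, the maximal runs of falses are the Kayles heaps and the legal
-- GA1 moves correspond exactly to the Kayles moves; hence the Grundy values agree for every
-- bit string. A string of n equal bits has the difference word of n − 1 falses: one heap.

open import Defs
open import Data.Bool using (Bool; true; false; not; _xor_; if_then_else_)
open import Data.Bool.Properties using (not-involutive; not-distribˡ-xor; not-distribʳ-xor; xor-same)
open import Data.Empty using (⊥-elim)
open import Data.Fin using (Fin; zero; suc)
open import Data.Nat
open import Data.Nat.Properties
open import Data.Product using (∃; ∃₂; _×_; _,_)
open import Data.Sum using (_⊎_; inj₁; inj₂)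
import Data.Sum as Sum
open import Data.Vec using (Vec; []; _∷_; replicate; updateAt)
open import Data.List using (List; []; _∷_; _++_; length; map)
import Data.List as List
open import Data.List.Properties using (filter-notAll; map-cong; map-∘; ∷-injective)
open import Data.List.Membership.Propositional using (_∈_; _∉_)
open import Data.List.Membership.Propositional.Properties
open import Data.List.Membership.DecPropositional _≟_ using (_∈?_)
open import Data.List.Relation.Binary.Subset.Propositional using (_⊆_)
open import Data.List.Relation.Binary.Subset.Propositional.Properties using (map⁺)
open import Data.List.Relation.Unary.Any using (here; there)
import Data.List.Relation.Unary.Any as Any
open import Function using (_∘_)
open import Relation.Nullary using (yes; no; ¬?)
open import Relation.Binary.PropositionalEquality
open ≡-Reasoning

covers⇒≤length : ∀ k {xs : List ℕ} → (∀ {j} → j < k → j ∈ xs) → k ≤ length xs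
covers⇒≤length zero    _ = z≤n
covers⇒≤length (suc k) {xs} covers = ≤-<-trans
  (covers⇒≤length k (λ j<k → ∈-filter⁺ ≢k? (covers (m<n⇒m<1+n j<k)) (<⇒≢ j<k)))
  (filter-notAll ≢k? xs (Any.map (λ k≡y y≢k → y≢k (sym k≡y)) (covers ≤-refl)))
  where ≢k? = λ y → ¬? (y ≟ k)

mexFrom-covers : ∀ f k xs {j} → k ≤ j → j < mexFrom f k xs → j ∈ xs
mexFrom-covers zero    k xs k≤j j<k = ⊥-elim (≤⇒≯ k≤j j<k)
mexFrom-covers (suc f) k xs {j} k≤j j<m with k ∈? xs
... | no  _  = ⊥-elim (≤⇒≯ k≤j j<m)
... | yes k∈ with k ≟ j
...   | yes refl = k∈
...   | no  k≢j  = mexFrom-covers f (suc k) xs (≤∧≢⇒< k≤j k≢j) j<m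

mexFrom-∉⊎exhausted : ∀ f k xs → mexFrom f k xs ∉ xs ⊎ mexFrom f k xs ≡ k + f
mexFrom-∉⊎exhausted zero    k xs = inj₂ (sym (+-identityʳ k))
mexFrom-∉⊎exhausted (suc f) k xs with k ∈? xs
... | no  k∉ = inj₁ k∉
... | yes _  = Sum.map₂ (λ eq → trans eq (sym (+-suc k f))) (mexFrom-∉⊎exhausted f (suc k) xs)

mex-covers : ∀ xs {j} → j < mex xs → j ∈ xs
mex-covers xs = mexFrom-covers (length xs) 0 xs z≤n

-- If the search ran out of fuel, all of 0, …, length xs would lie in xs: too many for xs.
mex-∉ : ∀ xs → mex xs ∉ xs
mex-∉ xs mex∈ with mexFrom-∉⊎exhausted (length xs) 0 xs
... | inj₁ mex∉      = mex∉ mex∈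
... | inj₂ mex≡length = <-irrefl mex≡length (covers⇒≤length (suc (mex xs)) covers)
  where
  covers : ∀ {j} → j < suc (mex xs) → j ∈ xs
  covers j<1+mex with m<1+n⇒m<n∨m≡n j<1+mex
  ... | inj₁ j<mex = mex-covers xs j<mex
  ... | inj₂ refl  = mex∈

mex-mono : ∀ {xs ys} → xs ⊆ ys → mex xs ≤ mex ys
mex-mono {xs} {ys} xs⊆ys = ≮⇒≥ (λ mexys<mexxs → mex-∉ ys (xs⊆ys (mex-covers xs mexys<mexxs)))

mex-cong : ∀ {xs ys} → xs ⊆ ys → ys ⊆ xs → mex xs ≡ mex ys
mex-cong xs⊆ys ys⊆xs = ≤-antisym (mex-mono xs⊆ys) (mex-mono ys⊆xs)

differences : ∀ {n} → Vec Bool n → List Bool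
differences []          = []
differences (x ∷ [])    = []
differences (x ∷ y ∷ v) = (x xor y) ∷ differences (y ∷ v)

trueCount : List Bool → ℕ
trueCount []          = 0
trueCount (true  ∷ d) = suc (trueCount d)
trueCount (false ∷ d) = trueCount d

entropy≡trueCount : ∀ {n} (v : Vec Bool n) → entropy v ≡ trueCount (differences v)
entropy≡trueCount []          = refl
entropy≡trueCount (x ∷ [])    = refl
entropy≡trueCount (x ∷ y ∷ v) =
  trans (cong (_ +_) (entropy≡trueCount (y ∷ v))) (trueCount-∷ (x xor y) (differences (y ∷ v)))
  where
  trueCount-∷ : ∀ b d → (if b then 1 else 0) + trueCount d ≡ trueCount (b ∷ d)
  trueCount-∷ true  d = refl
  trueCount-∷ false d = refl

data Flip : List Bool → List Bool → Set where
  one  : ∀ {b d}   → Flip (b ∷ d) (not b ∷ d)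
  two  : ∀ {b c d} → Flip (b ∷ c ∷ d) (not b ∷ not c ∷ d)
  skip : ∀ {b d e} → Flip d e → Flip (b ∷ d) (b ∷ e)

-- A false of the difference word is a standing pin, a true a knocked-down one.
data KnockDown : List Bool → List Bool → Set where
  one  : ∀ {d}     → KnockDown (false ∷ d) (true ∷ d)
  two  : ∀ {d}     → KnockDown (false ∷ false ∷ d) (true ∷ true ∷ d)
  skip : ∀ {b d e} → KnockDown d e → KnockDown (b ∷ d) (b ∷ e)

flip⇒knockDown : ∀ {d e} → Flip d e → trueCount d < trueCount e → KnockDown d e
flip⇒knockDown (one {false})             _  = one
flip⇒knockDown (one {true})              lt = ⊥-elim (≤⇒≯ (n≤1+n _) lt)
flip⇒knockDown (two {false} {false})     _  = two
flip⇒knockDown (two {false} {true})      lt = ⊥-elim (<-irrefl refl lt)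
flip⇒knockDown (two {true}  {false})     lt = ⊥-elim (<-irrefl refl lt)
flip⇒knockDown (two {true}  {true} {d})  lt = ⊥-elim (≤⇒≯ (m≤n+m (trueCount d) 2) lt)
flip⇒knockDown (skip {false} f)          lt = skip (flip⇒knockDown f lt)
flip⇒knockDown (skip {true}  f)          lt = skip (flip⇒knockDown f (s<s⁻¹ lt))

knockDown⇒flip : ∀ {d e} → KnockDown d e → Flip d e
knockDown⇒flip one      = one
knockDown⇒flip two      = two
knockDown⇒flip (skip k) = skip (knockDown⇒flip k)

knockDown-increases : ∀ {d e} → KnockDown d e → trueCount d < trueCount e
knockDown-increases one              = n<1+n _
knockDown-increases two              = m<n⇒m<1+n (n<1+n _)
knockDown-increases (skip {false} k) = knockDown-increases k
knockDown-increases (skip {true}  k) = s<s (knockDown-increases k)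

not-xor-not : ∀ x y → not x xor not y ≡ x xor y
not-xor-not true  y = refl
not-xor-not false y = not-involutive y

flipHead : ∀ {b c d} → c ≡ not b → Flip (b ∷ d) (c ∷ d)
flipHead refl = one

flipHead₂ : ∀ {b b′ c c′ d} → c ≡ not b → c′ ≡ not b′ → Flip (b ∷ b′ ∷ d) (c ∷ c′ ∷ d)
flipHead₂ refl refl = two

crossover-flips : ∀ {n} (v : Vec Bool n) {i} → i < n ∸ 1 →
  Flip (differences v) (differences (flipPrefix (suc i) v))
crossover-flips (x ∷ y ∷ v) {zero}  _         = flipHead (sym (not-distribˡ-xor x y))
crossover-flips (x ∷ y ∷ v) {suc i} (s≤s i<n) rewrite not-xor-not x y =
  skip (crossover-flips (y ∷ v) i<n)

mutation-flips : ∀ {n} (v : Vec Bool n) (j : Fin n) →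
  Flip (differences v) (differences (updateAt v j not)) ⊎ differences (updateAt v j not) ≡ differences v
mutation-flips (x ∷ [])        zero          = inj₂ refl
mutation-flips (x ∷ y ∷ v)     zero          = inj₁ (flipHead (sym (not-distribˡ-xor x y)))
mutation-flips (x ∷ y ∷ [])    (suc zero)    = inj₁ (flipHead (sym (not-distribʳ-xor x y)))
mutation-flips (x ∷ y ∷ z ∷ v) (suc zero)    =
  inj₁ (flipHead₂ (sym (not-distribʳ-xor x y)) (sym (not-distribˡ-xor y z)))
mutation-flips (x ∷ y ∷ v)     (suc (suc j)) =
  Sum.map skip (cong ((x xor y) ∷_)) (mutation-flips (y ∷ v) (suc j))

-- The mutation avoids the first bit, so prepending a bit to the string does not disturb it.
flip-realised : ∀ {n} (v : Vec Bool (suc n)) {e} → Flip (differences v) e →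
  (∃ λ i → i < n × differences (flipPrefix (suc i) v) ≡ e) ⊎
  (∃ λ j → differences (updateAt v (suc j) not) ≡ e)
flip-realised (x ∷ [])        ()
flip-realised (x ∷ y ∷ [])    one      = inj₁ (0 , z<s , cong (_∷ _) (sym (not-distribˡ-xor x y)))
flip-realised (x ∷ y ∷ [])    (skip ())
flip-realised (x ∷ y ∷ z ∷ v) one      = inj₁ (0 , z<s , cong (_∷ _) (sym (not-distribˡ-xor x y)))
flip-realised (x ∷ y ∷ z ∷ v) two      =
  inj₂ (zero , cong₂ (λ b c → b ∷ c ∷ _) (sym (not-distribʳ-xor x y)) (sym (not-distribˡ-xor y z)))
flip-realised (x ∷ y ∷ z ∷ v) (skip f) with flip-realised (y ∷ z ∷ v) f
... | inj₁ (i , i<n , eq) = inj₁ (suc i , s<s i<n , cong₂ _∷_ (not-xor-not x y) eq)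
... | inj₂ (j , eq)       = inj₂ (suc j , cong ((x xor y) ∷_) eq)

increasingMove-flips : ∀ {n} (v : Vec Bool n) {w} → w ∈ crossovers v ++ mutations v →
  trueCount (differences v) < trueCount (differences w) → Flip (differences v) (differences w)
increasingMove-flips v w∈ lt with ∈-++⁻ (crossovers v) w∈
... | inj₁ w∈crossovers with i , i∈ , refl ← ∈-map⁻ (λ i → flipPrefix (suc i) v) w∈crossovers =
  crossover-flips v (∈-upTo⁻ i∈)
... | inj₂ w∈mutations with j , _ , refl ← ∈-map⁻ (λ j → updateAt v j not) w∈mutations
                       with mutation-flips v j
...   | inj₁ f    = f
...   | inj₂ same = ⊥-elim (<-irrefl (cong trueCount (sym same)) lt)

knockDownCandidate⇒ga1Move : ∀ {n} (v : Vec Bool n) {w} → w ∈ crossovers v ++ mutations v →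
  KnockDown (differences v) (differences w) → w ∈ ga1Moves v
knockDownCandidate⇒ga1Move v {w} w∈ k = ∈-filter⁺ (λ w → entropy v <? entropy w) w∈
  (subst₂ _<_ (sym (entropy≡trueCount v)) (sym (entropy≡trueCount w)) (knockDown-increases k))

ga1Move⇒knockDown : ∀ {n} (v : Vec Bool n) {w} → w ∈ ga1Moves v →
  KnockDown (differences v) (differences w)
ga1Move⇒knockDown v {w} w∈ =
  let w∈candidates , increases = ∈-filter⁻ (λ w → entropy v <? entropy w) {xs = crossovers v ++ mutations v} w∈
      lt = subst₂ _<_ (entropy≡trueCount v) (entropy≡trueCount w) increases
  in flip⇒knockDown (increasingMove-flips v w∈candidates lt) lt

knockDown⇒ga1Move : ∀ {n} (v : Vec Bool n) {e} → KnockDown (differences v) e →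
  ∃ λ w → w ∈ ga1Moves v × differences w ≡ e
knockDown⇒ga1Move {zero}  []  ()
knockDown⇒ga1Move {suc n} v k with flip-realised v (knockDown⇒flip k)
... | inj₁ (i , i<n , eq) = flipPrefix (suc i) v ,
  knockDownCandidate⇒ga1Move v (∈-++⁺ˡ (∈-map⁺ _ (∈-upTo⁺ i<n))) (subst (KnockDown _) (sym eq) k) , eq
... | inj₂ (j , eq) = updateAt v (suc j) not ,
  knockDownCandidate⇒ga1Move v (∈-++⁺ʳ (crossovers v) (∈-map⁺ _ (∈-allFin (suc j))))
    (subst (KnockDown _) (sym eq) k) , eq

-- Lengths of the maximal runs of falses, empty runs included.
runLengths : List Bool → List ℕ
leadingRun : List Bool → ℕ
laterRuns  : List Bool → List ℕ

runLengths d = leadingRun d ∷ laterRuns d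

leadingRun []          = 0
leadingRun (false ∷ d) = suc (leadingRun d)
leadingRun (true  ∷ d) = 0

laterRuns []          = []
laterRuns (false ∷ d) = laterRuns d
laterRuns (true  ∷ d) = runLengths d

-- Kayles on positions that may contain empty heaps. Knocking down two pins leaves an empty
-- run between them, which removeTwo records as the middle heap 0.
data HeapMove : List ℕ → List ℕ → Set where
  removeOne : ∀ {h a b hs} → h ≡ suc (a + b)       → HeapMove (h ∷ hs) (a ∷ b ∷ hs)
  removeTwo : ∀ {h a b hs} → h ≡ suc (suc (a + b)) → HeapMove (h ∷ hs) (a ∷ 0 ∷ b ∷ hs)
  skip      : ∀ {h hs hs′} → HeapMove hs hs′ → HeapMove (h ∷ hs) (h ∷ hs′)

heapMove-sucHead : ∀ {h h′ hs hs′} → HeapMove (h ∷ hs) (h′ ∷ hs′) → HeapMove (suc h ∷ hs) (suc h′ ∷ hs′)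
heapMove-sucHead (removeOne eq) = removeOne (cong suc eq)
heapMove-sucHead (removeTwo eq) = removeTwo (cong suc eq)
heapMove-sucHead (skip m)       = skip m

knockDown⇒heapMove : ∀ {d e} → KnockDown d e → HeapMove (runLengths d) (runLengths e)
knockDown⇒heapMove one              = removeOne refl
knockDown⇒heapMove two              = removeTwo refl
knockDown⇒heapMove (skip {false} k) = heapMove-sucHead (knockDown⇒heapMove k)
knockDown⇒heapMove (skip {true}  k) = skip (knockDown⇒heapMove k)

knockDown-underFalse : ∀ {d h hs} → (∃ λ e → KnockDown d e × runLengths e ≡ h ∷ hs) →
  ∃ λ e → KnockDown (false ∷ d) e × runLengths e ≡ suc h ∷ hs
knockDown-underFalse (e , k , eq) =
  let leading≡h , later≡hs = ∷-injective eq in false ∷ e , skip k , cong₂ _∷_ (cong suc leading≡h) later≡hs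

heapMove⇒knockDown : ∀ d {hs} → HeapMove (runLengths d) hs → ∃ λ e → KnockDown d e × runLengths e ≡ hs
heapMove⇒knockDown []                 (removeOne ())
heapMove⇒knockDown []                 (removeTwo ())
heapMove⇒knockDown []                 (skip ())
heapMove⇒knockDown (true ∷ d)         (removeOne ())
heapMove⇒knockDown (true ∷ d)         (removeTwo ())
heapMove⇒knockDown (true ∷ d)         (skip m) =
  let e , k , eq = heapMove⇒knockDown d m in true ∷ e , skip k , cong (0 ∷_) eq
heapMove⇒knockDown (false ∷ d)        (removeOne {a = zero} refl) = true ∷ d , one , refl
heapMove⇒knockDown (false ∷ [])       (removeTwo {a = zero} ())
heapMove⇒knockDown (false ∷ true ∷ d) (removeTwo {a = zero} ())
heapMove⇒knockDown (false ∷ false ∷ d) (removeTwo {a = zero} refl) = true ∷ true ∷ d , two , refl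
heapMove⇒knockDown (false ∷ d)        (removeOne {a = suc a} eq) =
  knockDown-underFalse (heapMove⇒knockDown d (removeOne (suc-injective eq)))
heapMove⇒knockDown (false ∷ d)        (removeTwo {a = suc a} eq) =
  knockDown-underFalse (heapMove⇒knockDown d (removeTwo (suc-injective eq)))
heapMove⇒knockDown (false ∷ d)        (skip m) =
  knockDown-underFalse (heapMove⇒knockDown d (skip m))

dropZeros : List ℕ → List ℕ
dropZeros []           = []
dropZeros (zero  ∷ hs) = dropZeros hs
dropZeros (suc h ∷ hs) = suc h ∷ dropZeros hs

dropZeros-middle : ∀ a hs → dropZeros (a ∷ 0 ∷ hs) ≡ dropZeros (a ∷ hs)
dropZeros-middle zero    hs = refl
dropZeros-middle (suc a) hs = refl

∈-afterRemoval⁺ : ∀ a b hs → dropZeros (a ∷ b ∷ hs) ∈ afterRemoval (a + b) (dropZeros hs)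
∈-afterRemoval⁺ zero    zero    hs = here refl
∈-afterRemoval⁺ zero    (suc b) hs = here refl
∈-afterRemoval⁺ (suc a) zero    hs rewrite +-identityʳ a = here refl
∈-afterRemoval⁺ (suc a) (suc b) hs = there (∈-map⁺ _
  (subst (λ c → (suc a , c) ∈ splits (suc a + suc b)) (m+n∸m≡n a (suc b))
    (∈-map⁺ _ (∈-upTo⁺ (m<m+n a z<s)))))

∈-afterRemoval⁻ : ∀ r hs {q} → q ∈ afterRemoval r (dropZeros hs) →
  ∃₂ λ a b → a + b ≡ r × dropZeros (a ∷ b ∷ hs) ≡ q
∈-afterRemoval⁻ zero    hs (here refl) = 0 , 0 , refl , refl
∈-afterRemoval⁻ (suc r) hs (here refl) = 0 , suc r , refl , refl
∈-afterRemoval⁻ (suc r) hs (there q∈) with _ , split∈ , refl ← ∈-map⁻ _ q∈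
                                       with i , i∈ , refl ← ∈-map⁻ _ split∈
                                       with r ∸ i in r∸i≡ | ∈-upTo⁻ i∈
... | zero  | i<r = ⊥-elim (<-irrefl (sym r∸i≡) (m<n⇒0<n∸m i<r))
... | suc k | i<r = suc i , suc k , cong suc (trans (cong (i +_) (sym r∸i≡)) (m+[n∸m]≡n (<⇒≤ i<r))) , refl

heapMove-sound : ∀ {hs hs′} → HeapMove hs hs′ → dropZeros hs′ ∈ kaylesMoves (dropZeros hs)
heapMove-sound (removeOne {a = a} {b} {hs} refl) = ∈-++⁺ˡ (∈-afterRemoval⁺ a b hs)
heapMove-sound (removeTwo {a = a} {b} {hs} refl) rewrite dropZeros-middle a (b ∷ hs) =
  ∈-++⁺ʳ (removeK 1 (suc (suc (a + b))) (dropZeros hs)) (∈-++⁺ˡ (∈-afterRemoval⁺ a b hs))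
heapMove-sound (skip {zero}         m) = heapMove-sound m
heapMove-sound (skip {suc h} {hs}   m) =
  ∈-++⁺ʳ (removeK 1 (suc h) (dropZeros hs)) (∈-++⁺ʳ (removeK 2 (suc h) (dropZeros hs)) (∈-map⁺ _ (heapMove-sound m)))

heapMove-complete : ∀ hs {q} → q ∈ kaylesMoves (dropZeros hs) → ∃ λ hs′ → HeapMove hs hs′ × dropZeros hs′ ≡ q
heapMove-complete []           ()
heapMove-complete (zero ∷ hs)  q∈ =
  let hs′ , m , eq = heapMove-complete hs q∈ in zero ∷ hs′ , skip m , eq
heapMove-complete (suc h ∷ hs) q∈ with ∈-++⁻ (removeK 1 (suc h) (dropZeros hs)) q∈
... | inj₁ q∈removeOne with a , b , refl , eq ← ∈-afterRemoval⁻ h hs q∈removeOne =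
  a ∷ b ∷ hs , removeOne refl , eq
... | inj₂ q∈rest with h | ∈-++⁻ (removeK 2 (suc h) (dropZeros hs)) q∈rest
...   | zero    | inj₁ ()
...   | suc h′  | inj₁ q∈removeTwo with a , b , refl , eq ← ∈-afterRemoval⁻ h′ hs q∈removeTwo =
  a ∷ 0 ∷ b ∷ hs , removeTwo refl , trans (dropZeros-middle a (b ∷ hs)) eq
...   | _       | inj₂ q∈skip with q′ , q′∈ , refl ← ∈-map⁻ _ q∈skip =
  let hs′ , m , eq = heapMove-complete hs q′∈ in suc _ ∷ hs′ , skip m , cong (suc _ ∷_) eq

heaps : ∀ {n} → Vec Bool n → List ℕ
heaps v = dropZeros (runLengths (differences v))

heaps-ga1Moves⊆kaylesMoves : ∀ {n} (v : Vec Bool n) → map heaps (ga1Moves v) ⊆ kaylesMoves (heaps v)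
heaps-ga1Moves⊆kaylesMoves v q∈ with w , w∈ , refl ← ∈-map⁻ heaps q∈ =
  heapMove-sound (knockDown⇒heapMove (ga1Move⇒knockDown v w∈))

kaylesMoves⊆heaps-ga1Moves : ∀ {n} (v : Vec Bool n) → kaylesMoves (heaps v) ⊆ map heaps (ga1Moves v)
kaylesMoves⊆heaps-ga1Moves v {q} q∈ =
  let hs , m , hs≡q = heapMove-complete (runLengths (differences v)) q∈
      e , k , e≡hs  = heapMove⇒knockDown (differences v) m
      w , w∈ , w≡e  = knockDown⇒ga1Move v k
      heaps-w≡q = begin
        heaps w                      ≡⟨ cong (dropZeros ∘ runLengths) w≡e ⟩
        dropZeros (runLengths e)     ≡⟨ cong dropZeros e≡hs ⟩
        dropZeros hs                 ≡⟨ hs≡q ⟩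
        q                            ∎
  in subst (_∈ map heaps (ga1Moves v)) heaps-w≡q (∈-map⁺ heaps w∈)

ga1GrundyFuel≡kaylesGrundyFuel : ∀ f {n} (v : Vec Bool n) → ga1GrundyFuel f v ≡ kaylesGrundyFuel f (heaps v)
ga1GrundyFuel≡kaylesGrundyFuel zero    v = refl
ga1GrundyFuel≡kaylesGrundyFuel (suc f) v = begin
  mex (map (ga1GrundyFuel f) (ga1Moves v))
    ≡⟨ cong mex (map-cong (ga1GrundyFuel≡kaylesGrundyFuel f) (ga1Moves v)) ⟩
  mex (map (kaylesGrundyFuel f ∘ heaps) (ga1Moves v))
    ≡⟨ cong mex (map-∘ (ga1Moves v)) ⟩
  mex (map (kaylesGrundyFuel f) (map heaps (ga1Moves v)))
    ≡⟨ mex-cong (map⁺ _ (heaps-ga1Moves⊆kaylesMoves v)) (map⁺ _ (kaylesMoves⊆heaps-ga1Moves v)) ⟩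
  mex (map (kaylesGrundyFuel f) (kaylesMoves (heaps v)))
    ∎

differences-replicate : ∀ m b → differences (replicate (suc m) b) ≡ List.replicate m false
differences-replicate zero    b = refl
differences-replicate (suc m) b = cong₂ _∷_ (xor-same b) (differences-replicate m b)

runLengths-replicate : ∀ m → runLengths (List.replicate m false) ≡ m ∷ []
runLengths-replicate zero    = refl
runLengths-replicate (suc m) = let leading≡m , later≡[] = ∷-injective (runLengths-replicate m) in
  cong₂ _∷_ (cong suc leading≡m) later≡[]

kaylesGrundyFuel-dropZeros-heap : ∀ f h → kaylesGrundyFuel f (dropZeros (h ∷ [])) ≡ kaylesGrundyFuel f (h ∷ [])
kaylesGrundyFuel-dropZeros-heap zero    h       = refl
kaylesGrundyFuel-dropZeros-heap (suc f) zero    = refl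
kaylesGrundyFuel-dropZeros-heap (suc f) (suc h) = refl

theorem1 : (m : ℕ) (b : Bool) →
    ga1Grundy (replicate (suc m) b) ≡ kaylesGrundy (m ∷ [])
theorem1 m b = begin
  ga1GrundyFuel (suc m) (replicate (suc m) b)
    ≡⟨ ga1GrundyFuel≡kaylesGrundyFuel (suc m) (replicate (suc m) b) ⟩
  kaylesGrundyFuel (suc m) (heaps (replicate (suc m) b))
    ≡⟨ cong (kaylesGrundyFuel (suc m) ∘ dropZeros ∘ runLengths) (differences-replicate m b) ⟩
  kaylesGrundyFuel (suc m) (dropZeros (runLengths (List.replicate m false)))
    ≡⟨ cong (kaylesGrundyFuel (suc m) ∘ dropZeros) (runLengths-replicate m) ⟩
  kaylesGrundyFuel (suc m) (dropZeros (m ∷ []))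
    ≡⟨ kaylesGrundyFuel-dropZeros-heap (suc m) m ⟩
  kaylesGrundyFuel (suc m) (m ∷ [])
    ≡⟨ cong (λ k → kaylesGrundyFuel (suc k) (m ∷ [])) (sym (+-identityʳ m)) ⟩
  kaylesGrundy (m ∷ [])
    ∎
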